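{- Let $G=(V,E)$ be a connected undirected graph with $n=|V|\ge2$. For $X\subseteq V$, let $\mathcal{C}^*(X)$ be the set of vertex sets $C$ of connected components of $G-X$ with $|C|\ge2$, and define $f(X)=3^{n-2}-\sum_{C\in\mathcal{C}^*(X)}3^{|C|-2}$. Then $f$ satisfies: (P1) $f(\emptyset)=0$; (P2) $X\subseteq Y\subseteq V$ implies $f(X)\le f(Y)$; (P3) $f(X\cup Y)+f(X\cap Y)\le f(X)+f(Y)$ for all $X,Y\subseteq V$. That is, $(V,f)$ is a polymatroid. -}

module Defs where

open import Data.Nat using (ℕ; _≤_; _^_; _∸_)
open import Data.Integer using (ℤ; +_; _-_)
open import Data.Fin using (Fin)
open import Data.Fin.Subset using (Subset; _∈_; _∉_; ∣_∣; ⊥)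
open import Data.List using (List; map)
open import Data.Nat.ListAction using (sum)
open import Data.List.Relation.Unary.All using (All)
open import Data.List.Relation.Unary.Unique.Propositional using (Unique)
import Data.List.Membership.Propositional as L
open import Data.Product using (Σ; ∃; _×_)
open import Relation.Binary.PropositionalEquality using (_≡_)
open import Relation.Nullary using (Dec)

record Graph (n : ℕ) : Set₁ where
  field
    Adj     : Fin n → Fin n → Set
    Adj-sym : ∀ {u v} → Adj u v → Adj v u
    Adj-dec : ∀ u v → Dec (Adj u v)
open Graph public

-- Walks in G - X : every vertex of the walk lies outside X.
data Walk {n : ℕ} (G : Graph n) (X : Subset n) : Fin n → Fin n → Set where
  here : ∀ {u} → u ∉ X → Walk G X u u
  step : ∀ {u v w} → u ∉ X → Adj G u v → Walk G X v w → Walk G X u w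

Connected : ∀ {n} → Graph n → Set
Connected {n} G = ∀ (u v : Fin n) → Walk G ⊥ u v

IsComponent : ∀ {n} → Graph n → Subset n → Subset n → Set
IsComponent {n} G X C =
  (∃ λ u → u ∈ C) ×
  (∀ u → u ∈ C → u ∉ X) ×
  (∀ u v → u ∈ C → v ∈ C → Walk G X u v) ×
  (∀ u v → u ∈ C → Walk G X u v → v ∈ C)

IsBigComponent : ∀ {n} → Graph n → Subset n → Subset n → Set
IsBigComponent G X C = IsComponent G X C × (2 ≤ ∣ C ∣)

Enumerates : ∀ {n} → Graph n → Subset n → List (Subset n) → Set
Enumerates G X Cs =
  All (IsBigComponent G X) Cs ×
  (∀ C → IsBigComponent G X C → C L.∈ Cs) ×
  Unique Cs

fSum : ∀ {n} → ℕ → List (Subset n) → ℤ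
fSum n Cs = + (3 ^ (n ∸ 2)) - + sum (map (λ C → 3 ^ (∣ C ∣ ∸ 2)) Cs)

HasValue : ∀ {n} → Graph n → Subset n → ℤ → Set
HasValue {n} G X z = ∃ λ Cs → Enumerates G X Cs × z ≡ fSum n Cs

{-# OPTIONS --safe #-}
module Submission where

-- Write f X = 3 ^ (n ∸ 2) - g X, where g X sums ψ ∣ C ∣ over all components C of G - X,
-- with ψ c = 3 ^ (c ∸ 2) for c ≥ 2 and ψ 0 = ψ 1 = 0. For Z ⊆ Y every component of G - Y lies
-- inside a component K of G - Z, so g Y splits into contributions of the components K of G - Z.
-- If Y misses K the contribution is ψ ∣ K ∣. Otherwise the components inside K have fewer than
-- ∣ K ∣ vertices in total, so by superadditivity of ψ the contribution is at most ψ (∣ K ∣ - 1),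
-- and 2 ψ (c - 1) ≤ ψ c. Taking Z = X gives monotonicity; taking Z = X ∩ Y and distinguishing
-- which of X and Y meet K gives g X + g Y ≤ g (X ∪ Y) + g (X ∩ Y). Connectivity gives g ∅ = ψ n.

open import Defs

module ComponentWeights where

  open import Data.Bool using (true; false; if_then_else_)
  open import Data.Fin using (Fin; zero; suc)
  open import Data.Fin.Properties as Fin using (any?)
  open import Data.Fin.Subset using (Subset; _∈_; _∉_; ∣_∣; _⊆_; _⊂_; _∪_; _∩_; _─_; ⊥; ⊤; Nonempty; Empty)
  open import Data.Fin.Subset.Properties using (_∈?_; _⊂?_; x∈p∪q⁻; p⊆p∪q; q⊆p∪q; ⊆-antisym; x∈p∧x∉q⇒x∈p─q; p∩q≢∅⇒∣p─q∣<∣p∣; x∈p∩q⁺; nonempty?; p∩q⊆p; p∩q⊆q; ⊆⊤; ∣⊤∣≡n; p⊂q⇒∣p∣<∣q∣; ∣p∣≤n)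
  open import Data.Maybe as Maybe using (Maybe; just; nothing)
  import Data.Maybe.Properties as Maybeₚ
  open import Data.Nat
  open import Data.Nat.Properties
  open import Algebra.Properties.Semiring.Sum +-*-semiring
    using (sum-syntax; ∑-comm; ∑-distrib-+; sum-cong-≗) renaming (sum to ∑)
  open import Data.Product using (∃; _×_; _,_; proj₁; proj₂)
  open import Data.Sum using (_⊎_; inj₁; inj₂; [_,_])
  open import Data.List using (List; []; _∷_; map; filter; deduplicate; allFin)
  open import Data.List.Membership.Propositional.Properties
    using (∈-map∘filter⁺; ∈-map∘filter⁻; ∈-allFin; ∈-deduplicate⁺; ∈-deduplicate⁻)
  import Data.List.Membership.DecPropositional as DecMembership
  open import Data.List.Properties using (map-cong-local)
  open import Data.List.Relation.Unary.Unique.DecPropositional.Properties using (deduplicate-!)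
  open import Data.List.Relation.Unary.All as All using (All; []; _∷_)
  open import Data.List.Relation.Unary.Any using (here; there)
  open import Data.List.Relation.Unary.Unique.Propositional using (Unique; []; _∷_)
  import Data.List.Membership.Propositional as List
  open import Data.Nat.ListAction using (sum)
  open import Data.Vec using ([]; _∷_; tabulate; here; there)
  open import Data.Vec.Properties as Vec using (lookup∘tabulate; lookup⇒[]=; []=⇒lookup)
  import Data.Bool.Properties as Bool
  open import Function using (_∘_; id)
  open import Level using (0ℓ)
  open import Relation.Nullary using (Dec; yes; no; does; proof; ¬_; contradiction)
  open import Relation.Nullary.Decidable using (dec-true; _×-dec_; ¬?)
  open import Relation.Nullary.Reflects using (Reflects; invert)
  open import Relation.Unary using (Pred; Decidable)
  open import Relation.Binary.Definitions using (DecidableEquality)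
  open import Relation.Binary.PropositionalEquality
    using (_≡_; _≢_; refl; sym; trans; cong; cong₂; subst; module ≡-Reasoning)

  when : {A : Set} → Dec A → ℕ → ℕ
  when d x = if does d then x else 0

  module _ {A : Set} where

    when-yes : (d : Dec A) {x : ℕ} → A → when d x ≡ x
    when-yes (yes _) _ = refl
    when-yes (no ¬a) a = contradiction a ¬a

    when-no : (d : Dec A) {x : ℕ} → ¬ A → when d x ≡ 0
    when-no (yes a) ¬a = contradiction a ¬a
    when-no (no _) _ = refl

    when-zero : (d : Dec A) → when d 0 ≡ 0
    when-zero (yes _) = refl
    when-zero (no _) = refl

    when-≤ : (d : Dec A) {x : ℕ} → when d x ≤ x
    when-≤ (yes _) = ≤-refl
    when-≤ (no _) = z≤n

    when-monoʳ-≤ : (d : Dec A) {x y : ℕ} → x ≤ y → when d x ≤ when d y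
    when-monoʳ-≤ (yes _) x≤y = x≤y
    when-monoʳ-≤ (no _) _ = z≤n

    when-congʳ : (d : Dec A) {x y : ℕ} → (A → x ≡ y) → when d x ≡ when d y
    when-congʳ (yes a) x≡y = x≡y a
    when-congʳ (no _) _ = refl

    when-+ : (d : Dec A) (x y : ℕ) → when d (x + y) ≡ when d x + when d y
    when-+ (yes _) x y = refl
    when-+ (no _) x y = refl

    when-∑ : ∀ {m} (d : Dec A) (f : Fin m → ℕ) → when d (∑ f) ≡ ∑[ i < m ] when d (f i)
    when-∑ {zero} d f = when-zero d
    when-∑ {suc m} d f = trans (when-+ d (f zero) (∑ (f ∘ suc))) (cong (when d (f zero) +_) (when-∑ d (f ∘ suc)))

  ∑-mono-≤ : ∀ {m} {f g : Fin m → ℕ} → (∀ i → f i ≤ g i) → ∑ f ≤ ∑ g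
  ∑-mono-≤ {zero} _ = z≤n
  ∑-mono-≤ {suc m} f≤g = +-mono-≤ (f≤g zero) (∑-mono-≤ (f≤g ∘ suc))

  ∑-zero : ∀ {m} {f : Fin m → ℕ} → (∀ i → f i ≡ 0) → ∑ f ≡ 0
  ∑-zero {zero} _ = refl
  ∑-zero {suc m} f≡0 = cong₂ _+_ (f≡0 zero) (∑-zero (f≡0 ∘ suc))

  ∑-point : ∀ {m} (f : Fin m → ℕ) (j : Fin m) → (∀ i → i ≢ j → f i ≡ 0) → ∑ f ≡ f j
  ∑-point {suc m} f zero off =
    trans (cong (f zero +_) (∑-zero (λ i → off (suc i) λ ()))) (+-identityʳ (f zero))
  ∑-point {suc m} f (suc j) off =
    trans (cong (_+ ∑ (f ∘ suc)) (off zero λ ()))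
          (∑-point (f ∘ suc) j (λ i i≢j → off (suc i) (i≢j ∘ Fin.suc-injective)))

  ∣p∣≡∑ : ∀ {m} (p : Subset m) → ∣ p ∣ ≡ ∑[ i < m ] when (i ∈? p) 1
  ∣p∣≡∑ [] = refl
  ∣p∣≡∑ (true ∷ p) = cong suc (∣p∣≡∑ p)
  ∣p∣≡∑ (false ∷ p) = ∣p∣≡∑ p

  ψ : ℕ → ℕ
  ψ 0 = 0
  ψ 1 = 0
  ψ (suc (suc c)) = 3 ^ c

  ψ≡3^[∸2] : ∀ {c} → 2 ≤ c → ψ c ≡ 3 ^ (c ∸ 2)
  ψ≡3^[∸2] (s≤s (s≤s _)) = refl

  ψ-<2 : ∀ {c} → ¬ 2 ≤ c → ψ c ≡ 0
  ψ-<2 {0} _ = refl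
  ψ-<2 {1} _ = refl
  ψ-<2 {suc (suc c)} c≱2 = contradiction (s≤s (s≤s z≤n)) c≱2

  ψ-when : {A : Set} (d : Dec A) (x : ℕ) → when d (ψ x) ≡ ψ (when d x)
  ψ-when (yes _) x = refl
  ψ-when (no _) x = refl

  ψ-mono-≤ : ∀ {m n} → m ≤ n → ψ m ≤ ψ n
  ψ-mono-≤ {0} _ = z≤n
  ψ-mono-≤ {1} _ = z≤n
  ψ-mono-≤ {suc (suc m)} (s≤s (s≤s m≤n)) = ^-monoʳ-≤ 3 m≤n

  ψ-superadditive : ∀ m n → ψ m + ψ n ≤ ψ (m + n)
  ψ-superadditive 0 n = ≤-refl
  ψ-superadditive 1 n = ψ-mono-≤ (n≤1+n n)
  ψ-superadditive (suc (suc a)) 0 = ≤-trans (≤-reflexive (+-identityʳ _)) (ψ-mono-≤ (m≤m+n (2 + a) 0))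
  ψ-superadditive (suc (suc a)) 1 = ≤-trans (≤-reflexive (+-identityʳ _)) (ψ-mono-≤ (m≤m+n (2 + a) 1))
  ψ-superadditive (suc (suc a)) (suc (suc b)) = begin
    3 ^ a + 3 ^ b                 ≤⟨ +-mono-≤ (^-monoʳ-≤ 3 (m≤m+n a b)) (^-monoʳ-≤ 3 (m≤n+m b a)) ⟩
    3 ^ (a + b) + 3 ^ (a + b)     ≤⟨ +-mono-≤ (m≤n*m (3 ^ (a + b)) 3) (m≤n*m (3 ^ (a + b)) 3) ⟩
    3 ^ suc (a + b) + 3 ^ suc (a + b) ≤⟨ +-monoʳ-≤ (3 ^ suc (a + b)) (m≤m+n _ _) ⟩
    3 ^ suc (suc (a + b))         ≡⟨ cong (3 ^_) (sym (trans (+-suc a (suc b)) (cong suc (+-suc a b)))) ⟩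
    3 ^ (a + suc (suc b))         ∎
    where open ≤-Reasoning

  ψ-∑ : ∀ {m} (f : Fin m → ℕ) → ∑[ i < m ] ψ (f i) ≤ ψ (∑ f)
  ψ-∑ {zero} f = z≤n
  ψ-∑ {suc m} f =
    ≤-trans (+-monoʳ-≤ (ψ (f zero)) (ψ-∑ (f ∘ suc))) (ψ-superadditive (f zero) (∑ (f ∘ suc)))

  ψ-pred-double : ∀ m → ψ (pred m) + ψ (pred m) ≤ ψ m
  ψ-pred-double 0 = z≤n
  ψ-pred-double 1 = z≤n
  ψ-pred-double 2 = z≤n
  ψ-pred-double (suc (suc (suc j))) = +-monoʳ-≤ (3 ^ j) (m≤m+n (3 ^ j) _)

  module _ {n : ℕ} {P : Pred (Fin n) 0ℓ} (P? : Decidable P) where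

    fromDec : Subset n
    fromDec = tabulate (does ∘ P?)

    ∈-fromDec⁺ : ∀ {x} → P x → x ∈ fromDec
    ∈-fromDec⁺ {x} px = lookup⇒[]= x fromDec (trans (lookup∘tabulate (does ∘ P?) x) (dec-true (P? x) px))

    ∈-fromDec⁻ : ∀ {x} → x ∈ fromDec → P x
    ∈-fromDec⁻ {x} x∈ = invert (subst (Reflects (P x)) (trans (sym (lookup∘tabulate (does ∘ P?) x)) ([]=⇒lookup x∈)) (proof (P? x)))

  first : ∀ {n} → Subset n → Maybe (Fin n)
  first [] = nothing
  first (true ∷ p) = just zero
  first (false ∷ p) = Maybe.map suc (first p)

  first-∈ : ∀ {n} (p : Subset n) {i} → first p ≡ just i → i ∈ p
  first-∈ (true ∷ p) refl = here
  first-∈ (false ∷ p) e with first p in eq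
  first-∈ (false ∷ p) refl | just j = there (first-∈ p eq)

  first-nonempty : ∀ {n} (p : Subset n) {i} → i ∈ p → ∃ λ j → first p ≡ just j
  first-nonempty (true ∷ p) _ = zero , refl
  first-nonempty (false ∷ p) (there i∈p) with first-nonempty p i∈p
  ... | j , e rewrite e = suc j , refl

  module _ {A : Set} (_≟_ : DecidableEquality A) (h : A → ℕ) where

    sum-when-≟-absent : ∀ {y} xs → All (_≢ y) xs → sum (map (λ x → when (x ≟ y) (h x)) xs) ≡ 0
    sum-when-≟-absent [] [] = refl
    sum-when-≟-absent (x ∷ xs) (x≢y ∷ xs≢y) = cong₂ _+_ (when-no (x ≟ _) x≢y) (sum-when-≟-absent xs xs≢y)

    sum-when-≟-unique : ∀ {y} xs → Unique xs → y List.∈ xs → sum (map (λ x → when (x ≟ y) (h x)) xs) ≡ h y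
    sum-when-≟-unique (x ∷ xs) (x≢xs ∷ _) (here refl) = begin
      when (x ≟ x) (h x) + sum (map (λ z → when (z ≟ x) (h z)) xs)
        ≡⟨ cong₂ _+_ (when-yes (x ≟ x) refl) (sum-when-≟-absent xs (All.map (_∘ sym) x≢xs)) ⟩
      h x + 0
        ≡⟨ +-identityʳ (h x) ⟩
      h x ∎
      where open ≡-Reasoning
    sum-when-≟-unique (x ∷ xs) (x≢xs ∷ unique) (there y∈xs) =
      cong₂ _+_ (when-no (x ≟ _) (All.lookup x≢xs y∈xs)) (sum-when-≟-unique xs unique y∈xs)

  ∑-sum-comm : ∀ {A : Set} {m} (F : Fin m → A → ℕ) xs →
    ∑[ v < m ] sum (map (F v) xs) ≡ sum (map (λ x → ∑[ v < m ] F v x) xs)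
  ∑-sum-comm {m = m} F [] = ∑-zero {m} (λ _ → refl)
  ∑-sum-comm F (x ∷ xs) =
    trans (∑-distrib-+ (λ v → F v x) (λ v → sum (map (F v) xs))) (cong (∑ (λ v → F v x) +_) (∑-sum-comm F xs))

  module Components {n : ℕ} (G : Graph n) where

    private variable
      X Y Z : Subset n
      u v w : Fin n

    walk-source-∉ : Walk G X u w → u ∉ X
    walk-source-∉ (here u∉X) = u∉X
    walk-source-∉ (step u∉X _ _) = u∉X

    walk-target-∉ : Walk G X u w → w ∉ X
    walk-target-∉ (here w∉X) = w∉X
    walk-target-∉ (step _ _ p) = walk-target-∉ p

    walk-snoc : Walk G X u v → Adj G v w → w ∉ X → Walk G X u w
    walk-snoc (here u∉X) uw w∉X = step u∉X uw (here w∉X)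
    walk-snoc (step u∉X uv p) vw w∉X = step u∉X uv (walk-snoc p vw w∉X)

    walk-++ : Walk G X u v → Walk G X v w → Walk G X u w
    walk-++ (here _) q = q
    walk-++ (step u∉X uv p) q = step u∉X uv (walk-++ p q)

    walk-reverse : Walk G X u w → Walk G X w u
    walk-reverse (here u∉X) = here u∉X
    walk-reverse (step u∉X uv p) = walk-snoc (walk-reverse p) (Adj-sym G uv) u∉X

    walk-⊆ : X ⊆ Y → Walk G Y u w → Walk G X u w
    walk-⊆ X⊆Y (here u∉Y) = here (u∉Y ∘ X⊆Y)
    walk-⊆ X⊆Y (step u∉Y uv p) = step (u∉Y ∘ X⊆Y) uv (walk-⊆ X⊆Y p)

    walk-avoid : Walk G X u w → (∀ {c} → Walk G X u c → c ∉ Y) → Walk G Y u w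
    walk-avoid p@(here _) avoid = here (avoid p)
    walk-avoid (step u∉X uv p) avoid = step (avoid (here u∉X)) uv (walk-avoid p (avoid ∘ step u∉X uv))

    module Reach (X : Subset n) (v : Fin n) where

      source? : Decidable (λ w → w ≡ v × w ∉ X)
      source? w = (w Fin.≟ v) ×-dec ¬? (w ∈? X)

      entered? : (S : Subset n) → Decidable (λ b → b ∉ X × ∃ λ a → a ∈ S × Adj G a b)
      entered? S b = ¬? (b ∈? X) ×-dec any? (λ a → (a ∈? S) ×-dec Adj-dec G a b)

      frontier : Subset n → Subset n
      frontier S = fromDec (entered? S)

      expand : Subset n → Subset n
      expand S = S ∪ frontier S

      reach : ℕ → Subset n
      reach zero = fromDec source?
      reach (suc k) = expand (reach k)

      reach-sound : ∀ k → w ∈ reach k → Walk G X v w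
      reach-sound zero w∈ with ∈-fromDec⁻ source? w∈
      ... | refl , w∉X = here w∉X
      reach-sound (suc k) w∈ with x∈p∪q⁻ (reach k) _ w∈
      ... | inj₁ w∈reach = reach-sound k w∈reach
      ... | inj₂ w∈frontier with ∈-fromDec⁻ (entered? (reach k)) w∈frontier
      ...   | w∉X , a , a∈reach , aw = walk-snoc (reach-sound k a∈reach) aw w∉X

      reach-start : ∀ k → v ∉ X → v ∈ reach k
      reach-start zero v∉X = ∈-fromDec⁺ source? (refl , v∉X)
      reach-start (suc k) v∉X = p⊆p∪q _ (reach-start k v∉X)

      Closed : Subset n → Set
      Closed S = ∀ {a b} → a ∈ S → Adj G a b → b ∉ X → b ∈ S

      closed-walk : ∀ {S a} → Closed S → a ∈ S → Walk G X a w → w ∈ S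
      closed-walk closed a∈S (here _) = a∈S
      closed-walk closed a∈S (step _ ab p) = closed-walk closed (closed a∈S ab (walk-source-∉ p)) p

      ∈-frontier : ∀ {S a b} → a ∈ S → Adj G a b → b ∉ X → b ∈ frontier S
      ∈-frontier {S} {a} a∈S ab b∉X = ∈-fromDec⁺ (entered? S) (b∉X , a , a∈S , ab)

      expand-closed : ∀ {S} → Closed S → Closed (expand S)
      expand-closed {S} closed a∈ ab b∉X with x∈p∪q⁻ S _ a∈
      ... | inj₁ a∈S = p⊆p∪q _ (closed a∈S ab b∉X)
      ... | inj₂ a∈frontier with ∈-fromDec⁻ (entered? S) a∈frontier
      ...   | a∉X , c , c∈S , ca = p⊆p∪q _ (closed (closed c∈S ca a∉X) ab b∉X)

      stable-closed : ∀ {S} → ¬ (S ⊂ expand S) → Closed S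
      stable-closed {S} stable {b = b} a∈S ab b∉X with b ∈? S
      ... | yes b∈S = b∈S
      ... | no b∉S = contradiction ((λ {x} → p⊆p∪q _ {x}) , b , q⊆p∪q S _ (∈-frontier a∈S ab b∉X) , b∉S) stable

      closed-or-large : ∀ k → Closed (reach k) ⊎ k ≤ ∣ reach k ∣
      closed-or-large zero = inj₂ z≤n
      closed-or-large (suc k) with closed-or-large k
      ... | inj₁ closed = inj₁ (expand-closed closed)
      ... | inj₂ large with reach k ⊂? reach (suc k)
      ...   | yes grows = inj₂ (≤-trans (s≤s large) (p⊂q⇒∣p∣<∣q∣ grows))
      ...   | no stable = inj₁ (expand-closed (stable-closed stable))

      reach-closed : Closed (reach (suc n))
      reach-closed with closed-or-large (suc n)
      ... | inj₁ closed = closed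
      ... | inj₂ large = contradiction (∣p∣≤n (reach (suc n))) (<⇒≱ large)

    comp : Subset n → Fin n → Subset n
    comp X v = Reach.reach X v (suc n)

    comp-sound : w ∈ comp X v → Walk G X v w
    comp-sound {X = X} {v = v} = Reach.reach-sound X v (suc n)

    comp-complete : Walk G X v w → w ∈ comp X v
    comp-complete {X = X} {v = v} p =
      Reach.closed-walk X v (Reach.reach-closed X v) (Reach.reach-start X v (suc n) (walk-source-∉ p)) p

    comp-self : v ∉ X → v ∈ comp X v
    comp-self v∉X = comp-complete (here v∉X)

    comp-∉ : w ∈ comp X v → w ∉ X
    comp-∉ = walk-target-∉ ∘ comp-sound

    comp-≡ : w ∈ comp X v → comp X w ≡ comp X v
    comp-≡ w∈ = ⊆-antisym
      (λ x∈ → comp-complete (walk-++ (comp-sound w∈) (comp-sound x∈)))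
      (λ x∈ → comp-complete (walk-++ (walk-reverse (comp-sound w∈)) (comp-sound x∈)))

    comp-antitone : X ⊆ Y → comp Y v ⊆ comp X v
    comp-antitone X⊆Y = comp-complete ∘ walk-⊆ X⊆Y ∘ comp-sound

    -- A walk from v avoiding Y ⊇ Z stays inside comp Z v, where it also avoids X.
    comp-local : Z ⊆ Y → (∀ {c} → c ∈ comp Z v → c ∈ X → c ∈ Y) → comp Y v ⊆ comp X v
    comp-local Z⊆Y X⊆Y w∈ = comp-complete (walk-avoid (comp-sound w∈)
      (λ p c∈X → walk-target-∉ p (X⊆Y (comp-complete (walk-⊆ Z⊆Y p)) c∈X)))

    comp-isComponent : v ∉ X → IsComponent G X (comp X v)
    comp-isComponent {v} v∉X =
      (v , comp-self v∉X) ,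
      (λ _ → comp-∉) ,
      (λ a b a∈ b∈ → walk-++ (walk-reverse (comp-sound a∈)) (comp-sound b∈)) ,
      (λ a b a∈ p → comp-complete (walk-++ (comp-sound a∈) p))

    isComponent⇒≡comp : ∀ {C} → IsComponent G X C → u ∈ C → C ≡ comp X u
    isComponent⇒≡comp {u = u} (_ , _ , connected , closed) u∈C =
      ⊆-antisym (λ {w} w∈C → comp-complete (connected u w u∈C w∈C)) (λ {w} → closed u w u∈C ∘ comp-sound)

    _≟ₘ_ : (x y : Maybe (Fin n)) → Dec (x ≡ y)
    _≟ₘ_ = Maybeₚ.≡-dec Fin._≟_

    IsRep : Subset n → Fin n → Set
    IsRep X v = first (comp X v) ≡ just v

    rep? : ∀ X v → Dec (IsRep X v)
    rep? X v = first (comp X v) ≟ₘ just v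

    rep-∉ : IsRep X v → v ∉ X
    rep-∉ {X} {v} rep = comp-∉ (first-∈ (comp X v) rep)

    rep-unique : IsRep X u → IsRep X v → w ∈ comp X u → w ∈ comp X v → u ≡ v
    rep-unique rep-u rep-v w∈u w∈v = Maybeₚ.just-injective (begin
      just _             ≡⟨ sym rep-u ⟩
      first (comp _ _)   ≡⟨ cong first (trans (sym (comp-≡ w∈u)) (comp-≡ w∈v)) ⟩
      first (comp _ _)   ≡⟨ rep-v ⟩
      just _             ∎)
      where open ≡-Reasoning

    rep-exists : w ∉ X → ∃ λ r → IsRep X r × w ∈ comp X r
    rep-exists {w} {X} w∉X with first-nonempty (comp X w) (comp-self w∉X)
    ... | r , first≡r = r , trans (cong first r~w) first≡r , subst (w ∈_) (sym r~w) (comp-self w∉X)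
      where
      r~w : comp X r ≡ comp X w
      r~w = comp-≡ (first-∈ (comp X w) first≡r)

    -- Charging φ C to the first vertex of C counts every component of G - X exactly once.
    charge : (Subset n → ℕ) → Subset n → Fin n → ℕ
    charge φ C v = when (first C ≟ₘ just v) (φ C)

    ∑comp : Subset n → (Subset n → ℕ) → ℕ
    ∑comp X φ = ∑[ v < n ] charge φ (comp X v) v

    ∑compIn : Subset n → Subset n → (Subset n → ℕ) → ℕ
    ∑compIn X K φ = ∑[ v < n ] when (v ∈? K) (charge φ (comp X v) v)

    -- Each vertex outside X lies in the component of exactly one representative.
    ∑-reps : ∀ X w y → ∑[ k < n ] when (rep? X k) (when (w ∈? comp X k) y) ≡ when (¬? (w ∈? X)) y
    ∑-reps X w y with w ∈? X
    ... | yes w∈X = ∑-zero term≡0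
      where
      term≡0 : ∀ k → when (rep? X k) (when (w ∈? comp X k) y) ≡ 0
      term≡0 k with w ∈? comp X k
      ... | yes w∈k = contradiction w∈X (comp-∉ w∈k)
      ... | no _ = when-zero (rep? X k)
    ... | no w∉X with rep-exists w∉X
    ...   | r , rep-r , w∈r =
      trans (∑-point _ r off) (trans (when-yes (rep? X r) rep-r) (when-yes (w ∈? comp X r) w∈r))
      where
      off : ∀ k → k ≢ r → when (rep? X k) (when (w ∈? comp X k) y) ≡ 0
      off k k≢r with rep? X k | w ∈? comp X k
      ... | yes rep-k | yes w∈k = contradiction (rep-unique rep-k rep-r w∈k w∈r) k≢r
      ... | yes _ | no _ = refl
      ... | no _ | _ = refl

    -- Every component of G - Y lies in exactly one component of G - Z.
    ∑comp-refine : ∀ {φ} → Z ⊆ Y → ∑comp Y φ ≡ ∑comp Z (λ K → ∑compIn Y K φ)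
    ∑comp-refine {Z} {Y} {φ} Z⊆Y = begin
      ∑[ v < n ] a v
        ≡⟨ sum-cong-≗ outside-Z ⟩
      ∑[ v < n ] when (¬? (v ∈? Z)) (a v)
        ≡⟨ sum-cong-≗ (λ v → sym (∑-reps Z v (a v))) ⟩
      ∑[ v < n ] ∑[ k < n ] when (rep? Z k) (when (v ∈? comp Z k) (a v))
        ≡⟨ ∑-comm (λ v k → when (rep? Z k) (when (v ∈? comp Z k) (a v))) ⟩
      ∑[ k < n ] ∑[ v < n ] when (rep? Z k) (when (v ∈? comp Z k) (a v))
        ≡⟨ sum-cong-≗ (λ k → sym (when-∑ (rep? Z k) (λ v → when (v ∈? comp Z k) (a v)))) ⟩
      ∑comp Z (λ K → ∑compIn Y K φ) ∎
      where
      open ≡-Reasoning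
      a : Fin n → ℕ
      a v = charge φ (comp Y v) v
      outside-Z : ∀ v → a v ≡ when (¬? (v ∈? Z)) (a v)
      outside-Z v with v ∈? Z
      ... | yes v∈Z = when-no (rep? Y v) (λ rep → rep-∉ rep (Z⊆Y v∈Z))
      ... | no _ = refl

    ∑comp-+ : ∀ φ χ → ∑comp X (λ K → φ K + χ K) ≡ ∑comp X φ + ∑comp X χ
    ∑comp-+ {X} φ χ = trans (sum-cong-≗ (λ v → when-+ (rep? X v) (φ (comp X v)) (χ (comp X v))))
      (∑-distrib-+ (λ v → charge φ (comp X v) v) (λ v → charge χ (comp X v) v))

    ∑comp-mono-≤ : ∀ φ χ → (∀ {k} → IsRep X k → φ (comp X k) ≤ χ (comp X k)) → ∑comp X φ ≤ ∑comp X χ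
    ∑comp-mono-≤ {X} φ χ φ≤χ = ∑-mono-≤ term≤
      where
      term≤ : ∀ k → charge φ (comp X k) k ≤ charge χ (comp X k) k
      term≤ k with rep? X k
      ... | yes rep = φ≤χ rep
      ... | no _ = z≤n

    ∑compIn-self : ∀ {k φ} → IsRep X k → ∑compIn X (comp X k) φ ≡ φ (comp X k)
    ∑compIn-self {X} {k} {φ} rep-k =
      trans (∑-point _ k off) (trans (when-yes (k ∈? comp X k) (comp-self (rep-∉ rep-k))) (when-yes (rep? X k) rep-k))
      where
      off : ∀ v → v ≢ k → when (v ∈? comp X k) (charge φ (comp X v) v) ≡ 0
      off v v≢k with v ∈? comp X k | rep? X v
      ... | yes v∈k | yes rep-v = contradiction (rep-unique rep-v rep-k (comp-self (rep-∉ rep-v)) v∈k) v≢k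
      ... | yes _ | no _ = refl
      ... | no _ | _ = refl

    ∑compIn-local : ∀ {k φ} → Z ⊆ X → Z ⊆ Y →
      (∀ {c} → c ∈ comp Z k → c ∈ X → c ∈ Y) → (∀ {c} → c ∈ comp Z k → c ∈ Y → c ∈ X) →
      ∑compIn Y (comp Z k) φ ≡ ∑compIn X (comp Z k) φ
    ∑compIn-local {Z} {X} {Y} {k} {φ} Z⊆X Z⊆Y X→Y Y→X = sum-cong-≗ λ v → when-congʳ (v ∈? comp Z k) (same v)
      where
      same : ∀ v → v ∈ comp Z k → charge φ (comp Y v) v ≡ charge φ (comp X v) v
      same v v∈ = cong (λ C → charge φ C v)
        (⊆-antisym (comp-local Z⊆Y (X→Y ∘ inside)) (comp-local Z⊆X (Y→X ∘ inside)))
        where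
        inside : ∀ {c} → c ∈ comp Z v → c ∈ comp Z k
        inside {c} = subst (c ∈_) (comp-≡ v∈)

    ∑-reps-inside-≤ : ∀ {k} → Z ⊆ Y → ∀ w →
      ∑[ v < n ] when (v ∈? comp Z k) (when (rep? Y v) (when (w ∈? comp Y v) 1)) ≤ when (w ∈? comp Z k ─ Y) 1
    ∑-reps-inside-≤ {Z} {Y} {k} Z⊆Y w = begin
      ∑[ v < n ] when (v ∈? K) (when (rep? Y v) (when (w ∈? comp Y v) 1))
        ≤⟨ ∑-mono-≤ term≤ ⟩
      ∑[ v < n ] when (w ∈? K ─ Y) (when (rep? Y v) (when (w ∈? comp Y v) 1))
        ≡⟨ when-∑ (w ∈? K ─ Y) (λ v → when (rep? Y v) (when (w ∈? comp Y v) 1)) ⟨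
      when (w ∈? K ─ Y) (∑[ v < n ] when (rep? Y v) (when (w ∈? comp Y v) 1))
        ≡⟨ cong (when (w ∈? K ─ Y)) (∑-reps Y w 1) ⟩
      when (w ∈? K ─ Y) (when (¬? (w ∈? Y)) 1)
        ≤⟨ when-monoʳ-≤ (w ∈? K ─ Y) (when-≤ (¬? (w ∈? Y))) ⟩
      when (w ∈? K ─ Y) 1 ∎
      where
      open ≤-Reasoning
      K : Subset n
      K = comp Z k
      term≤ : ∀ v → when (v ∈? K) (when (rep? Y v) (when (w ∈? comp Y v) 1))
                  ≤ when (w ∈? K ─ Y) (when (rep? Y v) (when (w ∈? comp Y v) 1))
      term≤ v with v ∈? K | rep? Y v | w ∈? comp Y v
      ... | yes v∈K | yes _ | yes w∈ = ≤-reflexive (sym (when-yes (w ∈? K ─ Y)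
              (x∈p∧x∉q⇒x∈p─q (subst (w ∈_) (comp-≡ v∈K) (comp-antitone Z⊆Y w∈)) (comp-∉ w∈))))
      ... | yes _ | yes _ | no _ = z≤n
      ... | yes _ | no _ | _ = z≤n
      ... | no _ | _ | _ = z≤n

    ∑compIn-size : ∀ {k} → Z ⊆ Y → ∑compIn Y (comp Z k) ∣_∣ ≤ ∣ comp Z k ─ Y ∣
    ∑compIn-size {Z} {Y} {k} Z⊆Y = begin
      ∑compIn Y K ∣_∣
        ≡⟨ sum-cong-≗ (λ v → cong (λ s → when (v ∈? K) (when (rep? Y v) s)) (∣p∣≡∑ (comp Y v))) ⟩
      ∑[ v < n ] when (v ∈? K) (when (rep? Y v) (∑[ w < n ] when (w ∈? comp Y v) 1))
        ≡⟨ sum-cong-≗ (λ v → trans (cong (when (v ∈? K)) (when-∑ (rep? Y v) (λ w → when (w ∈? comp Y v) 1)))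
                                    (when-∑ (v ∈? K) (λ w → when (rep? Y v) (when (w ∈? comp Y v) 1)))) ⟩
      ∑[ v < n ] ∑[ w < n ] t v w
        ≡⟨ ∑-comm t ⟩
      ∑[ w < n ] ∑[ v < n ] t v w
        ≤⟨ ∑-mono-≤ (∑-reps-inside-≤ Z⊆Y) ⟩
      ∑[ w < n ] when (w ∈? K ─ Y) 1
        ≡⟨ ∣p∣≡∑ (K ─ Y) ⟨
      ∣ K ─ Y ∣ ∎
      where
      open ≤-Reasoning
      K : Subset n
      K = comp Z k
      t : Fin n → Fin n → ℕ
      t v w = when (v ∈? K) (when (rep? Y v) (when (w ∈? comp Y v) 1))

    weight : Subset n → ℕ
    weight C = ψ ∣ C ∣

    -- Components with fewer than two vertices weigh ψ 0 = ψ 1 = 0, so this is the sum over 𝒞*(X).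
    totalWeight : Subset n → ℕ
    totalWeight X = ∑comp X weight

    -- The components of G - Y inside K avoid a vertex of K ∩ Y; superadditivity of ψ does the rest.
    ∑compIn-weight-meeting : ∀ {k} → Z ⊆ Y → Nonempty (comp Z k ∩ Y) →
      ∑compIn Y (comp Z k) weight ≤ ψ (pred ∣ comp Z k ∣)
    ∑compIn-weight-meeting {Z} {Y} {k} Z⊆Y meets = begin
      ∑compIn Y K weight
        ≡⟨ sum-cong-≗ (λ v → trans (cong (when (v ∈? K)) (ψ-when (rep? Y v) ∣ comp Y v ∣))
                                    (ψ-when (v ∈? K) (charge ∣_∣ (comp Y v) v))) ⟩
      ∑[ v < n ] ψ (when (v ∈? K) (charge ∣_∣ (comp Y v) v))
        ≤⟨ ψ-∑ (λ v → when (v ∈? K) (charge ∣_∣ (comp Y v) v)) ⟩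
      ψ (∑compIn Y K ∣_∣)
        ≤⟨ ψ-mono-≤ (∑compIn-size Z⊆Y) ⟩
      ψ ∣ K ─ Y ∣
        ≤⟨ ψ-mono-≤ (<⇒≤pred (p∩q≢∅⇒∣p─q∣<∣p∣ K Y meets)) ⟩
      ψ (pred ∣ K ∣) ∎
      where
      open ≤-Reasoning
      K : Subset n
      K = comp Z k

    ∑compIn-missing : ∀ {k φ} → Z ⊆ Y → IsRep Z k → Empty (comp Z k ∩ Y) →
      ∑compIn Y (comp Z k) φ ≡ φ (comp Z k)
    ∑compIn-missing {Z} {Y} {k} {φ} Z⊆Y rep misses = trans
      (∑compIn-local {X = Z} {k = k} {φ} (λ z∈ → z∈) Z⊆Y (λ _ → Z⊆Y) (λ {c} c∈K c∈Y → contradiction (c , x∈p∩q⁺ (c∈K , c∈Y)) misses))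
      (∑compIn-self {φ = φ} rep)

    ∑compIn-weight-≤ : ∀ {k} → Z ⊆ Y → IsRep Z k → ∑compIn Y (comp Z k) weight ≤ weight (comp Z k)
    ∑compIn-weight-≤ {Z} {Y} {k} Z⊆Y rep with nonempty? (comp Z k ∩ Y)
    ... | yes meets = ≤-trans (∑compIn-weight-meeting {k = k} Z⊆Y meets) (ψ-mono-≤ (pred[n]≤n {∣ comp Z k ∣}))
    ... | no misses = ≤-reflexive (∑compIn-missing {φ = weight} Z⊆Y rep misses)

    totalWeight-antitone : X ⊆ Y → totalWeight Y ≤ totalWeight X
    totalWeight-antitone {X} {Y} X⊆Y = begin
      totalWeight Y
        ≡⟨ ∑comp-refine {φ = weight} X⊆Y ⟩
      ∑comp X (λ K → ∑compIn Y K weight)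
        ≤⟨ ∑comp-mono-≤ (λ K → ∑compIn Y K weight) weight (λ {k} → ∑compIn-weight-≤ {k = k} X⊆Y) ⟩
      totalWeight X ∎
      where open ≤-Reasoning

    ∑compIn-supermodular : ∀ X Y {k} → IsRep (X ∩ Y) k →
      ∑compIn X (comp (X ∩ Y) k) weight + ∑compIn Y (comp (X ∩ Y) k) weight
        ≤ ∑compIn (X ∪ Y) (comp (X ∩ Y) k) weight + weight (comp (X ∩ Y) k)
    ∑compIn-supermodular X Y {k} rep with nonempty? (comp (X ∩ Y) k ∩ X) | nonempty? (comp (X ∩ Y) k ∩ Y)
    ... | yes meetsX | yes meetsY = begin
      ∑compIn X K weight + ∑compIn Y K weight
        ≤⟨ +-mono-≤ (∑compIn-weight-meeting {k = k} (p∩q⊆p X Y) meetsX)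
                    (∑compIn-weight-meeting {k = k} (p∩q⊆q X Y) meetsY) ⟩
      ψ (pred ∣ K ∣) + ψ (pred ∣ K ∣)
        ≤⟨ ψ-pred-double ∣ K ∣ ⟩
      weight K
        ≤⟨ m≤n+m (weight K) _ ⟩
      ∑compIn (X ∪ Y) K weight + weight K ∎
      where
      open ≤-Reasoning
      K : Subset n
      K = comp (X ∩ Y) k
    ... | no missesX | _ = ≤-reflexive (trans (+-comm (∑compIn X K weight) _)
          (cong₂ _+_ (sym ∪≡Y) (∑compIn-missing {φ = weight} (p∩q⊆p X Y) rep missesX)))
      where
      K : Subset n
      K = comp (X ∩ Y) k
      ∪≡Y : ∑compIn (X ∪ Y) K weight ≡ ∑compIn Y K weight
      ∪≡Y = ∑compIn-local {k = k} {φ = weight} (p∩q⊆q X Y) (p⊆p∪q Y ∘ p∩q⊆p X Y) (λ _ → q⊆p∪q X Y)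
        (λ c∈K c∈X∪Y → [ (λ c∈X → contradiction (_ , x∈p∩q⁺ (c∈K , c∈X)) missesX) , id ] (x∈p∪q⁻ X Y c∈X∪Y))
    ... | yes _ | no missesY = ≤-reflexive
          (cong₂ _+_ (sym ∪≡X) (∑compIn-missing {φ = weight} (p∩q⊆q X Y) rep missesY))
      where
      K : Subset n
      K = comp (X ∩ Y) k
      ∪≡X : ∑compIn (X ∪ Y) K weight ≡ ∑compIn X K weight
      ∪≡X = ∑compIn-local {k = k} {φ = weight} (p∩q⊆p X Y) (p⊆p∪q Y ∘ p∩q⊆p X Y) (λ _ → p⊆p∪q Y)
        (λ c∈K c∈X∪Y → [ id , (λ c∈Y → contradiction (_ , x∈p∩q⁺ (c∈K , c∈Y)) missesY) ] (x∈p∪q⁻ X Y c∈X∪Y))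

    totalWeight-supermodular : ∀ X Y → totalWeight X + totalWeight Y ≤ totalWeight (X ∪ Y) + totalWeight (X ∩ Y)
    totalWeight-supermodular X Y = begin
      totalWeight X + totalWeight Y
        ≡⟨ cong₂ _+_ (∑comp-refine {φ = weight} (p∩q⊆p X Y)) (∑comp-refine {φ = weight} (p∩q⊆q X Y)) ⟩
      ∑comp X∩Y (λ K → ∑compIn X K weight) + ∑comp X∩Y (λ K → ∑compIn Y K weight)
        ≡⟨ ∑comp-+ (λ K → ∑compIn X K weight) (λ K → ∑compIn Y K weight) ⟨
      ∑comp X∩Y (λ K → ∑compIn X K weight + ∑compIn Y K weight)
        ≤⟨ ∑comp-mono-≤ (λ K → ∑compIn X K weight + ∑compIn Y K weight) (λ K → ∑compIn (X ∪ Y) K weight + weight K)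
                        (λ {k} → ∑compIn-supermodular X Y {k}) ⟩
      ∑comp X∩Y (λ K → ∑compIn (X ∪ Y) K weight + weight K)
        ≡⟨ ∑comp-+ (λ K → ∑compIn (X ∪ Y) K weight) weight ⟩
      ∑comp X∩Y (λ K → ∑compIn (X ∪ Y) K weight) + totalWeight X∩Y
        ≡⟨ cong (_+ totalWeight X∩Y) (∑comp-refine {φ = weight} (p⊆p∪q Y ∘ p∩q⊆p X Y)) ⟨
      totalWeight (X ∪ Y) + totalWeight X∩Y ∎
      where
      open ≤-Reasoning
      X∩Y : Subset n
      X∩Y = X ∩ Y

    comp-⊥ : Connected G → comp ⊥ v ≡ ⊤
    comp-⊥ {v} connected = ⊆-antisym ⊆⊤ (λ {w} _ → comp-complete (connected v w))

    _≟ₛ_ : DecidableEquality (Subset n)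
    _≟ₛ_ = Vec.≡-dec Bool._≟_

    ∑-component-first : ∀ {C} y → IsComponent G X C → ∑[ v < n ] when (C ≟ₛ comp X v) (when (rep? X v) y) ≡ y
    ∑-component-first {X} {C} y isC@((u , u∈C) , _) with first-nonempty C u∈C
    ... | r , first≡r = trans (∑-point _ r off)
          (trans (when-yes (C ≟ₛ comp X r) C≡r) (when-yes (rep? X r) (trans (cong first (sym C≡r)) first≡r)))
      where
      C≡r : C ≡ comp X r
      C≡r = isComponent⇒≡comp isC (first-∈ C first≡r)
      off : ∀ v → v ≢ r → when (C ≟ₛ comp X v) (when (rep? X v) y) ≡ 0
      off v v≢r with C ≟ₛ comp X v
      ... | yes C≡v = when-no (rep? X v)
            (λ rep → v≢r (Maybeₚ.just-injective (trans (sym rep) (trans (cong first (sym C≡v)) first≡r))))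
      ... | no _ = refl

    enumeration-sum : ∀ {Cs} → Enumerates G X Cs → sum (map (λ C → 3 ^ (∣ C ∣ ∸ 2)) Cs) ≡ totalWeight X
    enumeration-sum {X} {Cs} (big , complete , unique) = begin
      sum (map (λ C → 3 ^ (∣ C ∣ ∸ 2)) Cs)
        ≡⟨ cong sum (map-cong-local (All.map (λ {C} → sym ∘ ∑-component-first (3 ^ (∣ C ∣ ∸ 2)) ∘ proj₁) big)) ⟩
      sum (map (λ C → ∑[ v < n ] F v C) Cs)
        ≡⟨ ∑-sum-comm F Cs ⟨
      ∑[ v < n ] sum (map (F v) Cs)
        ≡⟨ sum-cong-≗ row ⟩
      totalWeight X ∎
      where
      open ≡-Reasoning
      F : Fin n → Subset n → ℕ
      F v C = when (C ≟ₛ comp X v) (when (rep? X v) (3 ^ (∣ C ∣ ∸ 2)))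
      row : ∀ v → sum (map (F v) Cs) ≡ charge weight (comp X v) v
      row v with DecMembership._∈?_ _≟ₛ_ (comp X v) Cs
      ... | yes listed = trans (sum-when-≟-unique _≟ₛ_ (λ C → when (rep? X v) (3 ^ (∣ C ∣ ∸ 2))) Cs unique listed)
            (when-congʳ (rep? X v) (λ _ → sym (ψ≡3^[∸2] (proj₂ (All.lookup big listed)))))
      ... | no unlisted = trans (sum-when-≟-absent _≟ₛ_ (λ C → when (rep? X v) (3 ^ (∣ C ∣ ∸ 2))) Cs
              (All.tabulate λ { C∈Cs refl → unlisted C∈Cs }))
            (sym (trans (when-congʳ (rep? X v) small) (when-zero (rep? X v))))
        where
        small : IsRep X v → weight (comp X v) ≡ 0
        small rep = ψ-<2 (λ 2≤ → unlisted (complete _ (comp-isComponent (rep-∉ rep) , 2≤)))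

    inBigComponent? : ∀ X → Decidable (λ v → v ∉ X × 2 ≤ ∣ comp X v ∣)
    inBigComponent? X v = ¬? (v ∈? X) ×-dec (2 ≤? ∣ comp X v ∣)

    bigComponents : Subset n → List (Subset n)
    bigComponents X = deduplicate _≟ₛ_ (map (comp X) (filter (inBigComponent? X) (allFin n)))

    bigComponents-enumerates : ∀ X → Enumerates G X (bigComponents X)
    bigComponents-enumerates X = All.tabulate listed⇒big , big⇒listed , deduplicate-! _≟ₛ_ _
      where
      listed⇒big : ∀ {C} → C List.∈ bigComponents X → IsBigComponent G X C
      listed⇒big C∈ with ∈-map∘filter⁻ (comp X) (inBigComponent? X) {xs = allFin n} (∈-deduplicate⁻ _≟ₛ_ _ C∈)
      ... | v , _ , refl , v∉X , 2≤ = comp-isComponent v∉X , 2≤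
      big⇒listed : ∀ C → IsBigComponent G X C → C List.∈ bigComponents X
      big⇒listed C (isC@((u , u∈C) , C∌X , _) , 2≤) with isComponent⇒≡comp isC u∈C
      ... | refl = ∈-deduplicate⁺ _≟ₛ_
        (∈-map∘filter⁺ (comp X) (inBigComponent? X) {xs = allFin n} (u , ∈-allFin u , refl , C∌X u u∈C , 2≤))

  totalWeight-⊥ : ∀ {m} (G : Graph (suc m)) → Connected G → Components.totalWeight G ⊥ ≡ ψ (suc m)
  totalWeight-⊥ {m} G connected = begin
    ∑[ v < suc m ] charge weight (comp ⊥ v) v
      ≡⟨ sum-cong-≗ (λ v → cong (λ C → charge weight C v) (comp-⊥ {v} connected)) ⟩
    ∑[ v < suc m ] charge weight ⊤ v
      ≡⟨ ∑-point (charge weight ⊤) zero off ⟩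
    charge weight ⊤ zero
      ≡⟨ when-yes (just zero ≟ₘ just zero) refl ⟩
    ψ ∣ ⊤ {suc m} ∣
      ≡⟨ cong ψ (∣⊤∣≡n (suc m)) ⟩
    ψ (suc m) ∎
    where
    open ≡-Reasoning
    open Components G
    off : ∀ v → v ≢ zero → charge weight ⊤ v ≡ 0
    off v v≢0 = when-no (just zero ≟ₘ just v) (λ e → v≢0 (sym (Maybeₚ.just-injective e)))

open import Data.Nat using (ℕ; _≤_; suc; _^_; _∸_)
open import Data.Integer using (ℤ; _+_; +_; _-_; +≤+) renaming (_≤_ to _≤ℤ_)
open import Data.Integer.Properties using (+-monoʳ-≤; neg-mono-≤; +-inverseʳ)
open import Data.Integer.Solver using (module +-*-Solver)
open import Data.Fin.Subset using (Subset; ⊥; _⊆_; _∪_; _∩_)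
open import Data.Product using (∃; _×_; _,_)
open import Relation.Binary.PropositionalEquality using (_≡_; refl; sym; trans; cong; cong₂; subst₂)
open ComponentWeights using (ψ≡3^[∸2]; totalWeight-⊥; module Components)

minus-antitone : ∀ k {p q} → p ≤ q → k - + q ≤ℤ k - + p
minus-antitone k p≤q = +-monoʳ-≤ k (neg-mono-≤ (+≤+ p≤q))

minus-+-minus : ∀ k p q → (k - p) + (k - q) ≡ (k + k) - (p + q)
minus-+-minus = solve 3 (λ k p q → (k :- p) :+ (k :- q) := (k :+ k) :- (p :+ q)) refl
  where open +-*-Solver

module _ {n : ℕ} (G : Graph n) where

  open Components G

  hasValue⇒≡ : ∀ {X z} → HasValue G X z → z ≡ + (3 ^ (n ∸ 2)) - + totalWeight X
  hasValue⇒≡ (Cs , enumerates , refl) = cong (λ s → + (3 ^ (n ∸ 2)) - + s) (enumeration-sum enumerates)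

  hasValue-+ : ∀ {X Y a b} → HasValue G X a → HasValue G Y b →
    a + b ≡ (+ (3 ^ (n ∸ 2)) + + (3 ^ (n ∸ 2))) - (+ totalWeight X + + totalWeight Y)
  hasValue-+ {X} {Y} valueX valueY = trans (cong₂ _+_ (hasValue⇒≡ valueX) (hasValue⇒≡ valueY))
    (minus-+-minus (+ (3 ^ (n ∸ 2))) (+ totalWeight X) (+ totalWeight Y))

lemma4 : ∀ (n : ℕ) → 2 ≤ n → (G : Graph n) → Connected G →
         (∀ (X : Subset n) → ∃ λ z → HasValue G X z) ×
         (∀ z → HasValue G ⊥ z → z ≡ + 0) ×
         (∀ (X Y : Subset n) (zX zY : ℤ) → X ⊆ Y → HasValue G X zX → HasValue G Y zY → zX ≤ℤ zY) ×
         (∀ (X Y : Subset n) (a b c d : ℤ) → HasValue G (X ∪ Y) a → HasValue G (X ∩ Y) b →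
            HasValue G X c → HasValue G Y d → (a + b) ≤ℤ (c + d))
lemma4 n@(suc _) 2≤n G connected = exists , at-⊥ , monotone , submodular
  where
  open Components G
  top : ℤ
  top = + (3 ^ (n ∸ 2))
  exists : ∀ X → ∃ λ z → HasValue G X z
  exists X = fSum n (bigComponents X) , bigComponents X , bigComponents-enumerates X , refl
  at-⊥ : ∀ z → HasValue G ⊥ z → z ≡ + 0
  at-⊥ z value = trans (hasValue⇒≡ G value)
    (trans (cong (λ s → top - + s) (trans (totalWeight-⊥ G connected) (ψ≡3^[∸2] 2≤n))) (+-inverseʳ top))
  monotone : ∀ X Y zX zY → X ⊆ Y → HasValue G X zX → HasValue G Y zY → zX ≤ℤ zY
  monotone X Y zX zY X⊆Y valueX valueY = subst₂ _≤ℤ_ (sym (hasValue⇒≡ G valueX)) (sym (hasValue⇒≡ G valueY))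
    (minus-antitone top (totalWeight-antitone X⊆Y))
  submodular : ∀ X Y a b c d → HasValue G (X ∪ Y) a → HasValue G (X ∩ Y) b →
               HasValue G X c → HasValue G Y d → (a + b) ≤ℤ (c + d)
  submodular X Y a b c d value∪ value∩ valueX valueY =
    subst₂ _≤ℤ_ (sym (hasValue-+ G value∪ value∩)) (sym (hasValue-+ G valueX valueY))
      (minus-antitone (top + top) (totalWeight-supermodular X Y))
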